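{- For every integer $n\ge0$, the matroid $M\!I_n$ on ground set $E_n$ with set of bases $\mathcal{B}_n$ is non-weakly-orientable.
   Context: For $n\ge0$ let $E_n=\{1,2,3,4,x_0,\dots,x_n,y_0,\dots,y_n,z_0,\dots,z_n\}$ (a set of $3n+7$ distinct elements), $X=\{x_0,\dots,x_n\}$, $Y=\{y_0,\dots,y_n\}$, $Z=\{z_0,\dots,z_n\}$. Define $H_1=\{1\}\cup Y\cup Z$, $H_2=\{2\}\cup X\cup Z$, $H_3=\{3\}\cup X\cup Y$, $C_1=\{1,4\}\cup X$, $C_2=\{2,4\}\cup Y$, $C_3=\{3,4\}\cup Z$, and $\mathcal{B}_n=\{B\subseteq E_n : |B|=n+3,\ \{1,2,3\}\not\subseteq B,\ B\not\subseteq C_i \text{ and } B\not\subseteq H_i \text{ for all } 1\le i\le 3\}$; this is the set of bases of a matroid $M\!I_n$ on $E_n$. A signed subset of a finite set $E$ is a pair $W=(W^+,W^-)$ of disjoint subsets of $E$; write $-W=(W^-,W^+)$ and $\underline{W}=W^+\cup W^-$. Two signed subsets $U,V$ are orthogonal if $(U^+\cap V^+)\cup(U^-\cap V^-)\neq\varnothing \iff (U^+\cap V^-)\cup(U^-\cap V^+)\neq\varnothing$. A matroid $M$ is weakly-orientable if there exist collections $\mathscr{O},\mathscr{O}^*$ of signed subsets of $E(M)$ such that $-\mathscr{O}=\mathscr{O}$, $-\mathscr{O}^*=\mathscr{O}^*$, whenever $U,W\in\mathscr{O}$ with $\underline{W}\subseteq\underline{U}$ then $W=\pm U$ (likewise for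 $\mathscr{O}^*$), $\{\underline{U}: U\in\mathscr{O}\}$ is the set of circuits of $M$, $\{\underline{V}:V\in\mathscr{O}^*\}$ is the set of cocircuits of $M$, and every $U\in\mathscr{O}$, $V\in\mathscr{O}^*$ with $|\underline{U}\cap\underline{V}|=2$ are orthogonal. -}

module Defs where

open import Data.Nat.Base using (ℕ; zero; suc; _+_; _*_; _<ᵇ_)
open import Data.Bool.Base using (Bool; true; false; if_then_else_)
open import Data.Fin.Base using (Fin; toℕ)
open import Data.Fin.Subset
  using (Subset; _∈_; _⊆_; _⊂_; ∁; _∩_; _∪_; ∣_∣; Nonempty)
open import Data.Vec.Base using (tabulate)
open import Data.Product.Base using (Σ; ∃; _×_)
open import Data.Sum.Base using (_⊎_)
open import Data.Empty using (⊥)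
open import Relation.Nullary using (¬_)
open import Relation.Binary.PropositionalEquality using (_≡_; _≢_)
open import Function.Bundles using (_⇔_)

Independent : {m : ℕ} → (Subset m → Set) → Subset m → Set
Independent {m} 𝓑 I = Σ (Subset m) (λ B → 𝓑 B × I ⊆ B)

Circuit : {m : ℕ} → (Subset m → Set) → Subset m → Set
Circuit {m} 𝓑 C =
  ¬ Independent 𝓑 C × ((D : Subset m) → D ⊂ C → Independent 𝓑 D)

DualBases : {m : ℕ} → (Subset m → Set) → Subset m → Set
DualBases 𝓑 B = 𝓑 (∁ B)

Cocircuit : {m : ℕ} → (Subset m → Set) → Subset m → Set
Cocircuit 𝓑 = Circuit (DualBases 𝓑)

record SignedSubset (m : ℕ) : Set where
  constructor signed
  field
    pos      : Subset m
    neg      : Subset m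
    disjoint : (x : Fin m) → x ∈ pos → x ∈ neg → ⊥
open SignedSubset public

-_ : {m : ℕ} → SignedSubset m → SignedSubset m
- W = signed (neg W) (pos W) (λ x a b → disjoint W x b a)

supp : {m : ℕ} → SignedSubset m → Subset m
supp W = pos W ∪ neg W

_≈ₛ_ : {m : ℕ} → SignedSubset m → SignedSubset m → Set
U ≈ₛ W = (pos U ≡ pos W) × (neg U ≡ neg W)

Orthogonal : {m : ℕ} → SignedSubset m → SignedSubset m → Set
Orthogonal U V =
  Nonempty ((pos U ∩ pos V) ∪ (neg U ∩ neg V))
  ⇔ Nonempty ((pos U ∩ neg V) ∪ (neg U ∩ pos V))

Collection : ℕ → Set₁
Collection m = SignedSubset m → Set

SymmetricColl : {m : ℕ} → Collection m → Set
SymmetricColl 𝒪 = (∀ U → 𝒪 U → 𝒪 (- U)) × (∀ W → 𝒪 W → Σ _ λ U → 𝒪 U × (W ≈ₛ (- U)))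

SignClean : {m : ℕ} → Collection m → Set
SignClean 𝒪 = ∀ U W → 𝒪 U → 𝒪 W → supp W ⊆ supp U → (W ≈ₛ U) ⊎ (W ≈ₛ (- U))

SupportsAre : {m : ℕ} → Collection m → (Subset m → Set) → Set
SupportsAre 𝒪 𝒞 =
  (∀ U → 𝒪 U → 𝒞 (supp U)) × (∀ C → 𝒞 C → Σ _ λ U → 𝒪 U × supp U ≡ C)

WeaklyOrientable : {m : ℕ} → (Subset m → Set) → Set₁
WeaklyOrientable {m} 𝓑 = Σ (Collection m) λ 𝒪 → Σ (Collection m) λ 𝒪* →
  SymmetricColl 𝒪 × SymmetricColl 𝒪* ×
  SignClean 𝒪 × SignClean 𝒪* ×
  SupportsAre 𝒪 (Circuit 𝓑) × SupportsAre 𝒪* (Cocircuit 𝓑) ×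
  (∀ U V → 𝒪 U → 𝒪* V → ∣ supp U ∩ supp V ∣ ≡ 2 → Orthogonal U V)

-- The matroid MI_n.
-- Ground set E_n = Fin (3n+7), written 4 + 3 * suc n, encoded as:
--   0,1,2,3 ↦ elements 1,2,3,4;  4+i ↦ x_i;  4+(n+1)+i ↦ y_i;
--   4+2(n+1)+i ↦ z_i   (0 ≤ i ≤ n).

size : ℕ → ℕ
size n = 4 + 3 * suc n

data Kind : Set where
  k1 k2 k3 k4 kx ky kz : Kind

kind : ℕ → ℕ → Kind
kind n 0 = k1
kind n 1 = k2
kind n 2 = k3
kind n 3 = k4
kind n (suc (suc (suc (suc j)))) =
  if j <ᵇ suc n then kx else (if j <ᵇ (suc n + suc n) then ky else kz)

byKind : (n : ℕ) → (Kind → Bool) → Subset (size n)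
byKind n P = tabulate (λ i → P (kind n (toℕ i)))

S123 H₁ H₂ H₃ C₁ C₂ C₃ : (n : ℕ) → Subset (size n)
S123 n = byKind n λ { k1 → true ; k2 → true ; k3 → true ; _ → false }
H₁ n = byKind n λ { k1 → true ; ky → true ; kz → true ; _ → false }
H₂ n = byKind n λ { k2 → true ; kx → true ; kz → true ; _ → false }
H₃ n = byKind n λ { k3 → true ; kx → true ; ky → true ; _ → false }
C₁ n = byKind n λ { k1 → true ; k4 → true ; kx → true ; _ → false }
C₂ n = byKind n λ { k2 → true ; k4 → true ; ky → true ; _ → false }
C₃ n = byKind n λ { k3 → true ; k4 → true ; kz → true ; _ → false }

MIBases : (n : ℕ) → Subset (size n) → Set
MIBases n B =
  ∣ B ∣ ≡ n + 3 ×
  ¬ (S123 n ⊆ B) ×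
  ¬ (B ⊆ C₁ n) × ¬ (B ⊆ C₂ n) × ¬ (B ⊆ C₃ n) ×
  ¬ (B ⊆ H₁ n) × ¬ (B ⊆ H₂ n) × ¬ (B ⊆ H₃ n)

module Submission where

open import Defs
open import Data.Nat.Base using (ℕ; zero; suc; _+_; _≤_; _<_; _<ᵇ_; z≤n; s≤s)
open import Data.Bool.Base using (Bool; true; false; not; _∧_; _xor_; if_then_else_)
open import Data.Bool.Properties
  using (not-injective; not-involutive; not-¬; ¬-not; not-distribʳ-xor; xor-comm)
  renaming (_≟_ to _≟ᵇ_)
open import Data.Empty using (⊥; ⊥-elim)
open import Data.Fin.Base using (Fin; toℕ; _↑ʳ_) renaming (zero to fzero; suc to fsuc)
open import Data.Fin.Properties using (_≟_; toℕ-↑ʳ)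
open import Data.Fin.Subset
  using (Subset; _∈_; _∉_; _⊆_; _⊂_; ∁; _∩_; _∪_; _-_; ⁅_⁆; ∣_∣; Nonempty)
open import Data.Fin.Subset.Properties
  using (_∈?_; ⊆-trans; p⊆p∪q; x∈p∪q⁺; x∈p∪q⁻; x∈p∩q⁺; x∈p∩q⁻; ∪-identityʳ;
         x∉p⇒x∈∁p; x∈p⇒x∉∁p; x∈∁p⇒x∉p; x∈⁅x⁆; x∈⁅y⁆⇒x≡y; x≢y⇒x∉⁅y⁆; ∣⁅x⁆∣≡1;
         p─⊥≡p; p─q⊆p; x∈p∧x≢y⇒x∈p-y; p⊂q⇒∣p∣<∣q∣)
open import Data.Nat.Tactic.RingSolver using (solve-∀)
open import Data.Nat.Properties
  using (<⇒≱; ≤-reflexive; m≤m+n; +-monoʳ-<; +-monoʳ-≤; +-assoc; +-suc; +-identityʳ)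
open import Data.Product.Base using (Σ; _×_; _,_; proj₁; proj₂)
open import Data.Sum.Base using (_⊎_; inj₁; inj₂)
open import Data.Vec.Base using (_∷_; here; there; lookup; map; tabulate; zipWith)
open import Data.Vec.Properties
  using ([]=⇒lookup; lookup⇒[]=; lookup∘tabulate; tabulate∘lookup; tabulate-cong;
         tabulate-∘; map-∘; map-cong; map-id)
open import Function.Bundles using (Equivalence)
open import Relation.Nullary using (¬_; yes; no)
open import Function.Base using (_∋_)
open import Relation.Binary.PropositionalEquality
  using (_≡_; _≢_; refl; sym; trans; cong; cong₂; subst; module ≡-Reasoning)

-- Suppose 𝒪, 𝒪* sign the circuits and cocircuits of M I_n.  Consider the
-- circuits {1,2,3}, C₁, C₂, C₃ and the cocircuits Kⱼ = E ∖ Hⱼ.  The circuit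
-- {1,2,3} meets Kⱼ in {1,2,3} ∖ {j}, and Cᵢ meets Kⱼ (j ≠ i) in {i, 4}.  On
-- each of these nine two-element intersections orthogonality forces the
-- signed circuit and cocircuit to have opposite sign parities; adding up the
-- parities around the triangle 1, 2, 3 (with detours through 4) gives a
-- contradiction.

∣p∪⁅x⁆∣≡1+∣p∣ : ∀ {m} {x : Fin m} {p : Subset m} → x ∉ p → ∣ p ∪ ⁅ x ⁆ ∣ ≡ suc ∣ p ∣
∣p∪⁅x⁆∣≡1+∣p∣ {x = fzero}  {true ∷ p}  x∉p = ⊥-elim (x∉p here)
∣p∪⁅x⁆∣≡1+∣p∣ {x = fzero}  {false ∷ p} x∉p = cong (λ q → suc ∣ q ∣) (∪-identityʳ p)
∣p∪⁅x⁆∣≡1+∣p∣ {x = fsuc x} {true ∷ p}  x∉p = cong suc (∣p∪⁅x⁆∣≡1+∣p∣ (λ x∈p → x∉p (there x∈p)))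
∣p∪⁅x⁆∣≡1+∣p∣ {x = fsuc x} {false ∷ p} x∉p = ∣p∪⁅x⁆∣≡1+∣p∣ (λ x∈p → x∉p (there x∈p))

1+∣p-x∣≡∣p∣ : ∀ {m} {x : Fin m} {p : Subset m} → x ∈ p → suc ∣ p - x ∣ ≡ ∣ p ∣
1+∣p-x∣≡∣p∣ {x = fzero}  {true ∷ p}  here        = cong (λ q → suc ∣ q ∣) (p─⊥≡p p)
1+∣p-x∣≡∣p∣ {x = fsuc x} {true ∷ p}  (there x∈p) = cong suc (1+∣p-x∣≡∣p∣ x∈p)
1+∣p-x∣≡∣p∣ {x = fsuc x} {false ∷ p} (there x∈p) = 1+∣p-x∣≡∣p∣ x∈p

⊆-equicardinal : ∀ {m} {p q : Subset m} → p ⊆ q → ∣ q ∣ ≤ ∣ p ∣ → q ⊆ p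
⊆-equicardinal {p = p} p⊆q ∣q∣≤∣p∣ {x} x∈q with x ∈? p
... | yes x∈p = x∈p
... | no  x∉p = ⊥-elim (<⇒≱ (p⊂q⇒∣p∣<∣q∣ (p⊆q , x , x∈q , x∉p)) ∣q∣≤∣p∣)

two-element : ∀ {m} {S : Subset m} {a b x : Fin m} →
  ∣ S ∣ ≡ 2 → a ∈ S → b ∈ S → a ≢ b → x ∈ S → x ≡ a ⊎ x ≡ b
two-element {S = S} {a} {b} ∣S∣≡2 a∈S b∈S a≢b x∈S =
  singleton-cases (x∈p∪q⁻ ⁅ a ⁆ ⁅ b ⁆ (⊆-equicardinal ab⊆S ∣S∣≤∣ab∣ x∈S))
  where
  singleton-cases : ∀ {y} → y ∈ ⁅ a ⁆ ⊎ y ∈ ⁅ b ⁆ → y ≡ a ⊎ y ≡ b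
  singleton-cases (inj₁ y∈a) = inj₁ (x∈⁅y⁆⇒x≡y a y∈a)
  singleton-cases (inj₂ y∈b) = inj₂ (x∈⁅y⁆⇒x≡y b y∈b)
  ab⊆S : ⁅ a ⁆ ∪ ⁅ b ⁆ ⊆ S
  ab⊆S y∈ab with singleton-cases (x∈p∪q⁻ ⁅ a ⁆ ⁅ b ⁆ y∈ab)
  ... | inj₁ refl = a∈S
  ... | inj₂ refl = b∈S
  ∣S∣≤∣ab∣ : ∣ S ∣ ≤ ∣ ⁅ a ⁆ ∪ ⁅ b ⁆ ∣
  ∣S∣≤∣ab∣ = ≤-reflexive (trans ∣S∣≡2
    (sym (trans (∣p∪⁅x⁆∣≡1+∣p∣ (x≢y⇒x∉⁅y⁆ (λ b≡a → a≢b (sym b≡a)))) (cong suc (∣⁅x⁆∣≡1 a)))))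

⊈-witness : ∀ {m} {p q : Subset m} {x : Fin m} → x ∈ p → x ∉ q → ¬ (p ⊆ q)
⊈-witness x∈p x∉q p⊆q = x∉q (p⊆q x∈p)

⊈-∪ : ∀ {m} {p q : Subset m} (r : Subset m) → ¬ (p ⊆ q) → ¬ (p ∪ r ⊆ q)
⊈-∪ r p⊈q p∪r⊆q = p⊈q (⊆-trans (p⊆p∪q r) p∪r⊆q)

⊈-remove : ∀ {m} {p q : Subset m} {a b : Fin m} →
  a ∈ p → b ∈ p → a ∉ q → b ∉ q → a ≢ b → (e : Fin m) → ¬ (p - e ⊆ q)
⊈-remove {a = a} a∈p b∈p a∉q b∉q a≢b e with a ≟ e
... | yes refl = ⊈-witness (x∈p∧x≢y⇒x∈p-y b∈p (λ b≡e → a≢b (sym b≡e))) b∉q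
... | no  a≢e  = ⊈-witness (x∈p∧x≢y⇒x∈p-y a∈p a≢e) a∉q

⊈-insert : ∀ {m} {p q : Subset m} {a b : Fin m} →
  a ∈ p → b ∈ p → a ∉ q → b ∉ q → a ≢ b → (e : Fin m) → ¬ (p ⊆ q ∪ ⁅ e ⁆)
⊈-insert {p = p} {q} a∈p b∈p a∉q b∉q a≢b e p⊆q+e = a≢b (trans (is-e a∈p a∉q) (sym (is-e b∈p b∉q)))
  where
  is-e : ∀ {x} → x ∈ p → x ∉ q → x ≡ e
  is-e x∈p x∉q with x∈p∪q⁻ q ⁅ e ⁆ (p⊆q+e x∈p)
  ... | inj₁ x∈q = ⊥-elim (x∉q x∈q)
  ... | inj₂ x∈e = x∈⁅y⁆⇒x≡y e x∈e

exchange : ∀ {m} → Subset m → Fin m → Fin m → Subset m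
exchange C e f = (C - e) ∪ ⁅ f ⁆

exchange-keeps : ∀ {m} {C : Subset m} {e f x : Fin m} → x ∈ C → x ≢ e → x ∈ exchange C e f
exchange-keeps x∈C x≢e = x∈p∪q⁺ (inj₁ (x∈p∧x≢y⇒x∈p-y x∈C x≢e))

exchange-adds : ∀ {m} (C : Subset m) (e f : Fin m) → f ∈ exchange C e f
exchange-adds C e f = x∈p∪q⁺ (inj₂ (x∈⁅x⁆ f))

∉-remove : ∀ {m} {C : Subset m} {x : Fin m} (e : Fin m) → x ∉ C → x ∉ C - e
∉-remove {C = C} e x∉C x∈C-e = x∉C (p─q⊆p C ⁅ e ⁆ x∈C-e)

∣exchange∣ : ∀ {m} {C : Subset m} {e f : Fin m} → e ∈ C → f ∉ C → ∣ exchange C e f ∣ ≡ ∣ C ∣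
∣exchange∣ {e = e} e∈C f∉C = trans (∣p∪⁅x⁆∣≡1+∣p∣ (∉-remove e f∉C)) (1+∣p-x∣≡∣p∣ e∈C)

exchange-⊈ : ∀ {m} {C T : Subset m} {a b : Fin m} →
  a ∈ C → b ∈ C → a ∉ T → b ∉ T → a ≢ b → (e f : Fin m) → ¬ (exchange C e f ⊆ T)
exchange-⊈ a∈C b∈C a∉T b∉T a≢b e f = ⊈-∪ ⁅ f ⁆ (⊈-remove a∈C b∈C a∉T b∉T a≢b e)

∁-involutive : ∀ {m} (p : Subset m) → ∁ (∁ p) ≡ p
∁-involutive p = begin
  map not (map not p)    ≡⟨ sym (map-∘ not not p) ⟩
  map (λ b → not (not b)) p  ≡⟨ map-cong not-involutive p ⟩
  map (λ b → b) p         ≡⟨ map-id p ⟩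
  p                       ∎
  where open ≡-Reasoning

dependent-by-size : ∀ {m} {𝓑 : Subset m → Set} {C : Subset m} →
  (∀ {B} → 𝓑 B → ∣ B ∣ ≡ ∣ C ∣) → (∀ {B} → 𝓑 B → ¬ (B ⊆ C)) → ¬ Independent 𝓑 C
dependent-by-size size no-basis-inside (B , b , C⊆B) =
  no-basis-inside b (⊆-equicardinal C⊆B (≤-reflexive (size b)))

circuit-intro : ∀ {m} {𝓑 : Subset m → Set} {C : Subset m} → ¬ Independent 𝓑 C →
  (∀ {e} → e ∈ C → Σ (Subset m) λ B → 𝓑 B × (∀ {x} → x ∈ C → x ≢ e → x ∈ B)) →
  Circuit 𝓑 C
circuit-intro {m} {𝓑} {C} dependent deletion = dependent , proper
  where
  proper : (D : Subset m) → D ⊂ C → Independent 𝓑 D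
  proper D (D⊆C , e , e∈C , e∉D) with deletion e∈C
  ... | B , b , C-e⊆B = B , b , λ d∈D → C-e⊆B (D⊆C d∈D) (λ d≡e → e∉D (subst (_∈ D) d≡e d∈D))

-- Dually, K is a cocircuit when it meets every basis and, for each e ∈ K,
-- some basis meets K in e alone (its complement is a dual basis containing
-- K ∖ {e}).
cocircuit-intro : ∀ {m} {𝓑 : Subset m → Set} {K : Subset m} →
  (∀ {B} → 𝓑 B → ¬ (∀ {x} → x ∈ K → x ∉ B)) →
  (∀ {e} → e ∈ K → Σ (Subset m) λ B → 𝓑 B × (∀ {x} → x ∈ K → x ≢ e → x ∉ B)) →
  Cocircuit 𝓑 K
cocircuit-intro {m} {𝓑} {K} meets avoids = circuit-intro dependent dual-basis
  where
  dependent : ¬ Independent (DualBases 𝓑) K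
  dependent (B* , b , K⊆B*) = meets b λ x∈K → x∈p⇒x∉∁p (K⊆B* x∈K)
  dual-basis : ∀ {e} → e ∈ K →
    Σ (Subset m) λ B* → DualBases 𝓑 B* × (∀ {x} → x ∈ K → x ≢ e → x ∈ B*)
  dual-basis e∈K with avoids e∈K
  ... | B , b , B∩K⊆e = ∁ B , subst 𝓑 (sym (∁-involutive B)) b ,
                        λ x∈K x≢e → x∉p⇒x∈∁p (B∩K⊆e x∈K x≢e)

exchange-circuit : ∀ {m} {𝓑 : Subset m → Set} {C : Subset m} (f : Fin m) →
  (∀ {B} → 𝓑 B → ∣ B ∣ ≡ ∣ C ∣) → (∀ {B} → 𝓑 B → ¬ (B ⊆ C)) →
  (∀ {e} → e ∈ C → 𝓑 (exchange C e f)) → Circuit 𝓑 C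
exchange-circuit {C = C} f size no-basis-inside exchange-basis =
  circuit-intro (dependent-by-size size no-basis-inside)
    λ {e} e∈C → exchange C e f , exchange-basis e∈C , λ x∈C x≢e → exchange-keeps x∈C x≢e

complement-cocircuit : ∀ {m} {𝓑 : Subset m → Set} {H A : Subset m} →
  (∀ {B} → 𝓑 B → ¬ (B ⊆ H)) → A ⊆ H → (∀ {e} → e ∉ H → 𝓑 (A ∪ ⁅ e ⁆)) →
  Cocircuit 𝓑 (∁ H)
complement-cocircuit {m} {𝓑} {H} {A} no-basis-inside A⊆H extend = cocircuit-intro meets avoids
  where
  meets : ∀ {B} → 𝓑 B → ¬ (∀ {x} → x ∈ ∁ H → x ∉ B)
  meets {B} b avoids-∁H = no-basis-inside b B⊆H
    where
    B⊆H : B ⊆ H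
    B⊆H {x} x∈B with x ∈? H
    ... | yes x∈H = x∈H
    ... | no  x∉H = ⊥-elim (avoids-∁H (x∉p⇒x∈∁p x∉H) x∈B)
  avoids : ∀ {e} → e ∈ ∁ H →
    Σ (Subset m) λ B → 𝓑 B × (∀ {x} → x ∈ ∁ H → x ≢ e → x ∉ B)
  avoids {e} e∈∁H = A ∪ ⁅ e ⁆ , extend (x∈∁p⇒x∉p e∈∁H) , outside
    where
    outside : ∀ {x} → x ∈ ∁ H → x ≢ e → x ∉ A ∪ ⁅ e ⁆
    outside {x} x∈∁H x≢e x∈A+e with x∈p∪q⁻ A ⁅ e ⁆ x∈A+e
    ... | inj₁ x∈A = x∈∁p⇒x∉p x∈∁H (A⊆H x∈A)
    ... | inj₂ x∈e = x≢e (x∈⁅y⁆⇒x≡y e x∈e)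

parity : {A : Set} → (A → Bool) → A → A → Bool
parity σ a b = σ a xor σ b

xor-cancel-middle : ∀ x y z → (x xor y) xor (z xor y) ≡ x xor z
xor-cancel-middle true  true  true  = refl
xor-cancel-middle true  true  false = refl
xor-cancel-middle true  false true  = refl
xor-cancel-middle true  false false = refl
xor-cancel-middle false true  true  = refl
xor-cancel-middle false true  false = refl
xor-cancel-middle false false true  = refl
xor-cancel-middle false false false = refl

not-xor-not : ∀ x y → not x xor not y ≡ x xor y
not-xor-not true  y = refl
not-xor-not false y = not-involutive y

parity-via : {A : Set} (σ : A → Bool) (a b c : A) →
  parity σ a b ≡ parity σ a c xor parity σ b c
parity-via σ a b c = sym (xor-cancel-middle (σ a) (σ c) (σ b))

sign : ∀ {m} → SignedSubset m → Fin m → Bool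
sign W x = lookup (pos W) x

part : ∀ {m} → SignedSubset m → Bool → Subset m
part W true  = pos W
part W false = neg W

sign-pos : ∀ {m} (W : SignedSubset m) {x : Fin m} → x ∈ pos W → sign W x ≡ true
sign-pos W = []=⇒lookup

sign-neg : ∀ {m} (W : SignedSubset m) {x : Fin m} → x ∈ neg W → sign W x ≡ false
sign-neg W {x} x∈W⁻ = ¬-not λ x∈W⁺ → disjoint W x (lookup⇒[]= x (pos W) x∈W⁺) x∈W⁻

part-of-sign : ∀ {m} (W : SignedSubset m) {x : Fin m} → x ∈ supp W → x ∈ part W (sign W x)
part-of-sign W {x} x∈W with x∈p∪q⁻ (pos W) (neg W) x∈W
... | inj₁ x∈W⁺ = subst (λ b → x ∈ part W b) (sym (sign-pos W x∈W⁺)) x∈W⁺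
... | inj₂ x∈W⁻ = subst (λ b → x ∈ part W b) (sym (sign-neg W x∈W⁻)) x∈W⁻

sign-of-part : ∀ {m} (W : SignedSubset m) {x : Fin m} (b : Bool) → x ∈ part W b → sign W x ≡ b
sign-of-part W true  = sign-pos W
sign-of-part W false = sign-neg W

part⊆supp : ∀ {m} (W : SignedSubset m) (b : Bool) → part W b ⊆ supp W
part⊆supp W true  x∈W⁺ = x∈p∪q⁺ (inj₁ x∈W⁺)
part⊆supp W false x∈W⁻ = x∈p∪q⁺ (inj₂ x∈W⁻)

module _ {m : ℕ} (U V : SignedSubset m) where

  agree disagree : Subset m
  agree    = (pos U ∩ pos V) ∪ (neg U ∩ neg V)
  disagree = (pos U ∩ neg V) ∪ (neg U ∩ pos V)

  agree⁺ : ∀ {x} → x ∈ supp U → x ∈ supp V → sign U x ≡ sign V x → x ∈ agree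
  agree⁺ {x} x∈U x∈V same =
    both (sign U x) (part-of-sign U x∈U) (subst (λ b → x ∈ part V b) (sym same) (part-of-sign V x∈V))
    where
    both : ∀ b → x ∈ part U b → x ∈ part V b → x ∈ agree
    both true  x∈U⁺ x∈V⁺ = x∈p∪q⁺ (inj₁ (x∈p∩q⁺ (x∈U⁺ , x∈V⁺)))
    both false x∈U⁻ x∈V⁻ = x∈p∪q⁺ (inj₂ (x∈p∩q⁺ (x∈U⁻ , x∈V⁻)))

  disagree⁺ : ∀ {x} → x ∈ supp U → x ∈ supp V → sign U x ≢ sign V x → x ∈ disagree
  disagree⁺ {x} x∈U x∈V opposite =
    both (sign U x) (part-of-sign U x∈U)
      (subst (λ b → x ∈ part V b) (¬-not (λ same → opposite (sym same))) (part-of-sign V x∈V))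
    where
    both : ∀ b → x ∈ part U b → x ∈ part V (not b) → x ∈ disagree
    both true  x∈U⁺ x∈V⁻ = x∈p∪q⁺ (inj₁ (x∈p∩q⁺ (x∈U⁺ , x∈V⁻)))
    both false x∈U⁻ x∈V⁺ = x∈p∪q⁺ (inj₂ (x∈p∩q⁺ (x∈U⁻ , x∈V⁺)))

  in-parts : ∀ {x} b c → x ∈ part U b × x ∈ part V c →
    x ∈ supp U ∩ supp V × sign U x ≡ b × sign V x ≡ c
  in-parts b c (x∈U , x∈V) =
    x∈p∩q⁺ (part⊆supp U b x∈U , part⊆supp V c x∈V) , sign-of-part U b x∈U , sign-of-part V c x∈V

  agree⁻ : ∀ {x} → x ∈ agree → x ∈ supp U ∩ supp V × sign U x ≡ sign V x
  agree⁻ x∈agree with x∈p∪q⁻ (pos U ∩ pos V) (neg U ∩ neg V) x∈agree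
  ... | inj₁ x∈U⁺V⁺ with in-parts true true (x∈p∩q⁻ (pos U) (pos V) x∈U⁺V⁺)
  ...   | x∈UV , u , v = x∈UV , trans u (sym v)
  agree⁻ x∈agree | inj₂ x∈U⁻V⁻ with in-parts false false (x∈p∩q⁻ (neg U) (neg V) x∈U⁻V⁻)
  ...   | x∈UV , u , v = x∈UV , trans u (sym v)

  disagree⁻ : ∀ {x} → x ∈ disagree → x ∈ supp U ∩ supp V × sign U x ≢ sign V x
  disagree⁻ x∈disagree with x∈p∪q⁻ (pos U ∩ neg V) (neg U ∩ pos V) x∈disagree
  ... | inj₁ x∈U⁺V⁻ with in-parts true false (x∈p∩q⁻ (pos U) (neg V) x∈U⁺V⁻)
  ...   | x∈UV , u , v = x∈UV , λ same → not-¬ refl (trans (sym u) (trans same v))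
  disagree⁻ x∈disagree | inj₂ x∈U⁻V⁺ with in-parts false true (x∈p∩q⁻ (neg U) (pos V) x∈U⁻V⁺)
  ...   | x∈UV , u , v = x∈UV , λ same → not-¬ refl (trans (sym u) (trans same v))

opposite-parities : ∀ {u₁ v₁ u₂ v₂ : Bool} → u₁ ≡ v₁ → u₂ ≢ v₂ → u₁ xor u₂ ≡ not (v₁ xor v₂)
opposite-parities {u₁} {v₂ = v₂} refl u₂≢v₂ rewrite ¬-not u₂≢v₂ = sym (not-distribʳ-xor u₁ v₂)

opposite-parities′ : ∀ {u₁ v₁ u₂ v₂ : Bool} → u₁ ≢ v₁ → u₂ ≡ v₂ → u₁ xor u₂ ≡ not (v₁ xor v₂)
opposite-parities′ {u₁} {v₁} {u₂} {v₂} u₁≢v₁ u₂≡v₂ =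
  trans (xor-comm u₁ u₂) (trans (opposite-parities u₂≡v₂ u₁≢v₁) (cong not (xor-comm v₂ v₁)))

-- Agreement at both would make the agreement set nonempty and the
-- disagreement set empty, and symmetrically.
module _ {m : ℕ} (U V : SignedSubset m) {a b : Fin m}
         (∣U∩V∣≡2 : ∣ supp U ∩ supp V ∣ ≡ 2)
         (a∈UV : a ∈ supp U ∩ supp V) (b∈UV : b ∈ supp U ∩ supp V) (a≢b : a ≢ b) where

  private
    a∈U : a ∈ supp U
    a∈U = proj₁ (x∈p∩q⁻ (supp U) (supp V) a∈UV)
    a∈V : a ∈ supp V
    a∈V = proj₂ (x∈p∩q⁻ (supp U) (supp V) a∈UV)

    at-a-or-b : (Q : Fin m → Set) {x : Fin m} → x ∈ supp U ∩ supp V → Q x → Q a ⊎ Q b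
    at-a-or-b Q x∈UV Qx with two-element ∣U∩V∣≡2 a∈UV b∈UV a≢b x∈UV
    ... | inj₁ refl = inj₁ Qx
    ... | inj₂ refl = inj₂ Qx

    no-disagreement : sign U a ≡ sign V a → sign U b ≡ sign V b → ¬ Nonempty (disagree U V)
    no-disagreement a-same b-same (x , x∈disagree) with disagree⁻ U V x∈disagree
    ... | x∈UV , opposite with at-a-or-b (λ y → sign U y ≢ sign V y) x∈UV opposite
    ...   | inj₁ a-opp = a-opp a-same
    ...   | inj₂ b-opp = b-opp b-same

    no-agreement : sign U a ≢ sign V a → sign U b ≢ sign V b → ¬ Nonempty (agree U V)
    no-agreement a-opp b-opp (x , x∈agree) with agree⁻ U V x∈agree
    ... | x∈UV , same with at-a-or-b (λ y → sign U y ≡ sign V y) x∈UV same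
    ...   | inj₁ a-same = a-opp a-same
    ...   | inj₂ b-same = b-opp b-same

  orthogonal-pair : Orthogonal U V → parity (sign U) a b ≡ not (parity (sign V) a b)
  orthogonal-pair orth with sign U a ≟ᵇ sign V a | sign U b ≟ᵇ sign V b
  ... | yes a-same | no  b-opp  = opposite-parities a-same b-opp
  ... | no  a-opp  | yes b-same = opposite-parities′ a-opp b-same
  ... | yes a-same | yes b-same =
    ⊥-elim (no-disagreement a-same b-same (Equivalence.to orth (a , agree⁺ U V a∈U a∈V a-same)))
  ... | no  a-opp  | no  b-opp  =
    ⊥-elim (no-agreement a-opp b-opp (Equivalence.from orth (a , disagree⁺ U V a∈U a∈V a-opp)))

<ᵇ-true : ∀ {m k} → m < k → (m <ᵇ k) ≡ true
<ᵇ-true {zero}  {suc k} _         = refl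
<ᵇ-true {suc m} {suc k} (s≤s m<k) = <ᵇ-true m<k

<ᵇ-false : ∀ {m k} → k ≤ m → (m <ᵇ k) ≡ false
<ᵇ-false {m}     {zero}  _         = refl
<ᵇ-false {suc m} {suc k} (s≤s k≤m) = <ᵇ-false k≤m

kind-x : ∀ n {j} → j < suc n → kind n (4 + j) ≡ kx
kind-x n {j} j<1+n rewrite <ᵇ-true j<1+n = refl

kind-y : ∀ n {i} → i < suc n → kind n (4 + (suc n + i)) ≡ ky
kind-y n {i} i<1+n
  rewrite <ᵇ-false {suc n + i} {suc n} (m≤m+n (suc n) i)
        | <ᵇ-true (+-monoʳ-< (suc n) i<1+n) = refl

kind-z : ∀ n i → kind n (4 + (suc n + (suc n + i))) ≡ kz
kind-z n i
  rewrite <ᵇ-false {suc n + (suc n + i)} {suc n} (m≤m+n (suc n) _)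
        | <ᵇ-false {suc n + (suc n + i)} {suc n + suc n} (+-monoʳ-≤ (suc n) (m≤m+n (suc n) i)) = refl

indicator : Bool → ℕ
indicator b = if b then 1 else 0

count : (ℕ → Bool) → ℕ → ℕ
count h zero    = 0
count h (suc m) = indicator (h 0) + count (λ j → h (suc j)) m

∣tabulate∣≡count : ∀ m (h : ℕ → Bool) → ∣ tabulate {n = m} (λ i → h (toℕ i)) ∣ ≡ count h m
∣tabulate∣≡count zero    h = refl
∣tabulate∣≡count (suc m) h with h 0
... | true  = cong suc (∣tabulate∣≡count m (λ j → h (suc j)))
... | false = ∣tabulate∣≡count m (λ j → h (suc j))

count-+ : ∀ a b (h : ℕ → Bool) → count h (a + b) ≡ count h a + count (λ j → h (a + j)) b
count-+ zero    b h = refl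
count-+ (suc a) b h = trans (cong (indicator (h 0) +_) (count-+ a b (λ j → h (suc j))))
                            (sym (+-assoc (indicator (h 0)) _ _))

count-constant : ∀ b (h : ℕ → Bool) (c : Bool) → (∀ {j} → j < b → h j ≡ c) →
  count h b ≡ (if c then b else 0)
count-constant zero    h true  _      = refl
count-constant zero    h false _      = refl
count-constant (suc b) h c     h≡c rewrite h≡c (s≤s z≤n)
  with count-constant b (λ j → h (suc j)) c (λ j<b → h≡c (s≤s j<b))
count-constant (suc b) h true  h≡c | rest = cong suc rest
count-constant (suc b) h false h≡c | rest = rest

kindCount : ℕ → (Kind → Bool) → ℕ
kindCount n P = block (P kx) + (block (P ky) + (block (P kz) + small))
  where
  block : Bool → ℕ
  block c = if c then suc n else 0
  small : ℕ
  small = indicator (P k1) + (indicator (P k2) + (indicator (P k3) + indicator (P k4)))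

∣byKind∣ : ∀ n P → ∣ byKind n P ∣ ≡ kindCount n P
∣byKind∣ n P = begin
  ∣ byKind n P ∣                        ≡⟨ ∣tabulate∣≡count (size n) (λ j → P (kind n j)) ⟩
  count (λ j → P (kind n j)) (size n)   ≡⟨ cong (λ r → i₁ + (i₂ + (i₃ + (i₄ + r)))) blocks ⟩
  i₁ + (i₂ + (i₃ + (i₄ + (bx + (by + bz))))) ≡⟨ rearrange i₁ i₂ i₃ i₄ bx by bz ⟩
  kindCount n P                         ∎
  where
  open ≡-Reasoning
  i₁ i₂ i₃ i₄ bx by bz : ℕ
  i₁ = indicator (P k1)
  i₂ = indicator (P k2)
  i₃ = indicator (P k3)
  i₄ = indicator (P k4)
  bx = if P kx then suc n else 0
  by = if P ky then suc n else 0
  bz = if P kz then suc n else 0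
  rearrange : ∀ a b c d x y z → a + (b + (c + (d + (x + (y + z))))) ≡ x + (y + (z + (a + (b + (c + d)))))
  rearrange = solve-∀
  h : ℕ → Bool
  h j = P (kind n (4 + j))
  blocks : count h (suc n + (suc n + (suc n + 0))) ≡ bx + (by + bz)
  blocks = trans (count-+ (suc n) _ h)
    (cong₂ _+_ (count-constant (suc n) h (P kx) (λ j<1+n → cong P (kind-x n j<1+n)))
      (trans (count-+ (suc n) _ (λ j → h (suc n + j)))
        (cong₂ _+_ (count-constant (suc n) _ (P ky) (λ i<1+n → cong P (kind-y n i<1+n)))
          (trans (cong (count (λ j → h (suc n + (suc n + j)))) (+-identityʳ (suc n)))
            (count-constant (suc n) _ (P kz) (λ {i} _ → cong P (kind-z n i)))))))

lookup-byKind : ∀ n P (x : Fin (size n)) → lookup (byKind n P) x ≡ P (kind n (toℕ x))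
lookup-byKind n P = lookup∘tabulate (λ i → P (kind n (toℕ i)))

∈-byKind : ∀ {n} (P : Kind → Bool) {x : Fin (size n)} {k} →
  kind n (toℕ x) ≡ k → P k ≡ true → x ∈ byKind n P
∈-byKind {n} P {x} refl Pk = lookup⇒[]= x (byKind n P) (trans (lookup-byKind n P x) Pk)

∉-byKind : ∀ {n} (P : Kind → Bool) {x : Fin (size n)} {k} →
  kind n (toℕ x) ≡ k → P k ≡ false → x ∉ byKind n P
∉-byKind {n} P {x} refl ¬Pk x∈P = not-¬ refl
  (trans (sym ¬Pk) (trans (sym (lookup-byKind n P x)) ([]=⇒lookup x∈P)))

byKind-∈ : ∀ {n} (P : Kind → Bool) {x : Fin (size n)} → x ∈ byKind n P → P (kind n (toℕ x)) ≡ true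
byKind-∈ {n} P {x} x∈P = trans (sym (lookup-byKind n P x)) ([]=⇒lookup x∈P)

∩-byKind : ∀ n P Q → byKind n P ∩ byKind n Q ≡ byKind n (λ k → P k ∧ Q k)
∩-byKind n P Q = zipWith-tabulate _∧_ (λ i → P (kind n (toℕ i))) (λ i → Q (kind n (toℕ i)))
  where
  zipWith-tabulate : ∀ {m} (f : Bool → Bool → Bool) (g h : Fin m → Bool) →
    zipWith f (tabulate g) (tabulate h) ≡ tabulate (λ i → f (g i) (h i))
  zipWith-tabulate {zero}  f g h = refl
  zipWith-tabulate {suc m} f g h =
    cong (f (g fzero) (h fzero) ∷_) (zipWith-tabulate f (λ i → g (fsuc i)) (λ i → h (fsuc i)))

e₁ e₂ e₃ e₄ x₀ y₀ z₀ : {n : ℕ} → Fin (size n)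
e₁ = fzero
e₂ = fsuc fzero
e₃ = fsuc (fsuc fzero)
e₄ = fsuc (fsuc (fsuc fzero))
x₀ = fsuc (fsuc (fsuc (fsuc fzero)))
y₀ {n} = 4 ↑ʳ (suc n ↑ʳ fzero)
z₀ {n} = 4 ↑ʳ (suc n ↑ʳ (suc n ↑ʳ fzero))

kind-y₀ : ∀ {n} → kind n (toℕ (y₀ {n})) ≡ ky
kind-y₀ {n} = trans (cong (kind n) (trans (toℕ-↑ʳ 4 _) (cong (4 +_) (toℕ-↑ʳ (suc n) fzero))))
                    (kind-y n (s≤s z≤n))

kind-z₀ : ∀ {n} → kind n (toℕ (z₀ {n})) ≡ kz
kind-z₀ {n} = trans (cong (kind n) (trans (toℕ-↑ʳ 4 _)
                      (cong (4 +_) (trans (toℕ-↑ʳ (suc n) _) (cong (suc n +_) (toℕ-↑ʳ (suc n) fzero))))))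
                    (kind-z n 0)

rep : ∀ {n} → Kind → Fin (size n)
rep k1 = e₁
rep k2 = e₂
rep k3 = e₃
rep k4 = e₄
rep kx = x₀
rep ky = y₀
rep kz = z₀

kind-rep : ∀ {n} k → kind n (toℕ (rep {n} k)) ≡ k
kind-rep k1 = refl
kind-rep k2 = refl
kind-rep k3 = refl
kind-rep k4 = refl
kind-rep kx = refl
kind-rep {n} ky = kind-y₀ {n}
kind-rep {n} kz = kind-z₀ {n}

rep-injective : ∀ {n} {k l} → rep {n} k ≡ rep l → k ≡ l
rep-injective {n} {k} {l} eq =
  trans (sym (kind-rep k)) (trans (cong (λ x → kind n (toℕ x)) eq) (kind-rep l))

_∖ᵏ_ : (Kind → Bool) → (Kind → Bool) → Kind → Bool
(P ∖ᵏ Q) k = P k ∧ not (Q k)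

∖ᵏ-split : ∀ {P Q : Kind → Bool} k → (P ∖ᵏ Q) k ≡ true → P k ≡ true × Q k ≡ false
∖ᵏ-split {P} {Q} k PQk with P k | Q k
... | true | false = refl , refl

rep-∖ᵏ : ∀ {n} (P Q : Kind → Bool) k → (P ∖ᵏ Q) k ≡ true →
  rep {n} k ∈ byKind n P × rep {n} k ∉ byKind n Q
rep-∖ᵏ P Q k PQk = ∈-byKind P (kind-rep k) (proj₁ (∖ᵏ-split {P} {Q} k PQk)) ,
                   ∉-byKind Q (kind-rep k) (proj₂ (∖ᵏ-split {P} {Q} k PQk))

⊈ᵏ : ∀ {n} (P Q : Kind → Bool) k → (P ∖ᵏ Q) k ≡ true → ¬ (byKind n P ⊆ byKind n Q)
⊈ᵏ P Q k PQk = ⊈-witness (proj₁ (rep-∖ᵏ P Q k PQk)) (proj₂ (rep-∖ᵏ P Q k PQk))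

exchange-⊈ᵏ : ∀ {n} (P Q : Kind → Bool) k l → (P ∖ᵏ Q) k ≡ true → (P ∖ᵏ Q) l ≡ true → k ≢ l →
  (e f : Fin (size n)) → ¬ (exchange (byKind n P) e f ⊆ byKind n Q)
exchange-⊈ᵏ P Q k l PQk PQl k≢l =
  exchange-⊈ (proj₁ (rep-∖ᵏ P Q k PQk)) (proj₁ (rep-∖ᵏ P Q l PQl))
             (proj₂ (rep-∖ᵏ P Q k PQk)) (proj₂ (rep-∖ᵏ P Q l PQl)) (λ eq → k≢l (rep-injective eq))

insert-⊈ᵏ : ∀ {n} (P : Kind → Bool) {A : Subset (size n)} k l →
  P k ≡ true → P l ≡ true → rep k ∉ A → rep l ∉ A → k ≢ l →
  (f : Fin (size n)) → ¬ (byKind n P ⊆ A ∪ ⁅ f ⁆)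
insert-⊈ᵏ P k l Pk Pl k∉A l∉A k≢l =
  ⊈-insert (∈-byKind P (kind-rep k) Pk) (∈-byKind P (kind-rep l) Pl) k∉A l∉A
           (λ eq → k≢l (rep-injective eq))

∁-byKind : ∀ n (Q : Kind → Bool) → ∁ (byKind n Q) ≡ byKind n (λ k → not (Q k))
∁-byKind n Q = sym (tabulate-∘ not (λ i → Q (kind n (toℕ i))))

byKind-⊆ : ∀ {n} (P Q : Kind → Bool) → (∀ k → P k ≡ true → Q k ≡ true) → byKind n P ⊆ byKind n Q
byKind-⊆ P Q P⇒Q x∈P = ∈-byKind Q refl (P⇒Q _ (byKind-∈ P x∈P))

inS : Kind → Bool
inS = λ { k1 → true ; k2 → true ; k3 → true ; _ → false }

inH₁ : Kind → Bool
inH₁ = λ { k1 → true ; ky → true ; kz → true ; _ → false }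

inH₂ : Kind → Bool
inH₂ = λ { k2 → true ; kx → true ; kz → true ; _ → false }

inH₃ : Kind → Bool
inH₃ = λ { k3 → true ; kx → true ; ky → true ; _ → false }

inC₁ : Kind → Bool
inC₁ = λ { k1 → true ; k4 → true ; kx → true ; _ → false }

inC₂ : Kind → Bool
inC₂ = λ { k2 → true ; k4 → true ; ky → true ; _ → false }

inC₃ : Kind → Bool
inC₃ = λ { k3 → true ; k4 → true ; kz → true ; _ → false }

byKind-ext : ∀ n {S : Subset (size n)} (P : Kind → Bool) →
  (∀ x → lookup S x ≡ P (kind n (toℕ x))) → S ≡ byKind n P
byKind-ext n {S} P entrywise = trans (sym (tabulate∘lookup S)) (tabulate-cong entrywise)

S123-byKind : ∀ n → S123 n ≡ byKind n inS
S123-byKind n = byKind-ext n inS entrywise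
  where
  entrywise : ∀ x → lookup (S123 n) x ≡ inS (kind n (toℕ x))
  entrywise fzero = refl
  entrywise (fsuc fzero) = refl
  entrywise (fsuc (fsuc fzero)) = refl
  entrywise (fsuc (fsuc (fsuc fzero))) = refl
  entrywise (fsuc (fsuc (fsuc (fsuc fzero)))) = refl
  entrywise (fsuc (fsuc (fsuc (fsuc (fsuc j)))))
    with (lookup (S123 n) (fsuc (fsuc (fsuc (fsuc (fsuc j))))) ≡ _) ∋ lookup∘tabulate _ j
  ... | entry with toℕ j <ᵇ n | toℕ j <ᵇ n + suc n
  ... | true  | _     = entry
  ... | false | true  = entry
  ... | false | false = entry

H₁-byKind : ∀ n → H₁ n ≡ byKind n inH₁
H₁-byKind n = byKind-ext n inH₁ entrywise
  where
  entrywise : ∀ x → lookup (H₁ n) x ≡ inH₁ (kind n (toℕ x))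
  entrywise fzero = refl
  entrywise (fsuc fzero) = refl
  entrywise (fsuc (fsuc fzero)) = refl
  entrywise (fsuc (fsuc (fsuc fzero))) = refl
  entrywise (fsuc (fsuc (fsuc (fsuc fzero)))) = refl
  entrywise (fsuc (fsuc (fsuc (fsuc (fsuc j)))))
    with (lookup (H₁ n) (fsuc (fsuc (fsuc (fsuc (fsuc j))))) ≡ _) ∋ lookup∘tabulate _ j
  ... | entry with toℕ j <ᵇ n | toℕ j <ᵇ n + suc n
  ... | true  | _     = entry
  ... | false | true  = entry
  ... | false | false = entry

H₂-byKind : ∀ n → H₂ n ≡ byKind n inH₂
H₂-byKind n = byKind-ext n inH₂ entrywise
  where
  entrywise : ∀ x → lookup (H₂ n) x ≡ inH₂ (kind n (toℕ x))
  entrywise fzero = refl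
  entrywise (fsuc fzero) = refl
  entrywise (fsuc (fsuc fzero)) = refl
  entrywise (fsuc (fsuc (fsuc fzero))) = refl
  entrywise (fsuc (fsuc (fsuc (fsuc fzero)))) = refl
  entrywise (fsuc (fsuc (fsuc (fsuc (fsuc j)))))
    with (lookup (H₂ n) (fsuc (fsuc (fsuc (fsuc (fsuc j))))) ≡ _) ∋ lookup∘tabulate _ j
  ... | entry with toℕ j <ᵇ n | toℕ j <ᵇ n + suc n
  ... | true  | _     = entry
  ... | false | true  = entry
  ... | false | false = entry

H₃-byKind : ∀ n → H₃ n ≡ byKind n inH₃
H₃-byKind n = byKind-ext n inH₃ entrywise
  where
  entrywise : ∀ x → lookup (H₃ n) x ≡ inH₃ (kind n (toℕ x))
  entrywise fzero = refl
  entrywise (fsuc fzero) = refl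
  entrywise (fsuc (fsuc fzero)) = refl
  entrywise (fsuc (fsuc (fsuc fzero))) = refl
  entrywise (fsuc (fsuc (fsuc (fsuc fzero)))) = refl
  entrywise (fsuc (fsuc (fsuc (fsuc (fsuc j)))))
    with (lookup (H₃ n) (fsuc (fsuc (fsuc (fsuc (fsuc j))))) ≡ _) ∋ lookup∘tabulate _ j
  ... | entry with toℕ j <ᵇ n | toℕ j <ᵇ n + suc n
  ... | true  | _     = entry
  ... | false | true  = entry
  ... | false | false = entry

C₁-byKind : ∀ n → C₁ n ≡ byKind n inC₁
C₁-byKind n = byKind-ext n inC₁ entrywise
  where
  entrywise : ∀ x → lookup (C₁ n) x ≡ inC₁ (kind n (toℕ x))
  entrywise fzero = refl
  entrywise (fsuc fzero) = refl
  entrywise (fsuc (fsuc fzero)) = refl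
  entrywise (fsuc (fsuc (fsuc fzero))) = refl
  entrywise (fsuc (fsuc (fsuc (fsuc fzero)))) = refl
  entrywise (fsuc (fsuc (fsuc (fsuc (fsuc j)))))
    with (lookup (C₁ n) (fsuc (fsuc (fsuc (fsuc (fsuc j))))) ≡ _) ∋ lookup∘tabulate _ j
  ... | entry with toℕ j <ᵇ n | toℕ j <ᵇ n + suc n
  ... | true  | _     = entry
  ... | false | true  = entry
  ... | false | false = entry

C₂-byKind : ∀ n → C₂ n ≡ byKind n inC₂
C₂-byKind n = byKind-ext n inC₂ entrywise
  where
  entrywise : ∀ x → lookup (C₂ n) x ≡ inC₂ (kind n (toℕ x))
  entrywise fzero = refl
  entrywise (fsuc fzero) = refl
  entrywise (fsuc (fsuc fzero)) = refl
  entrywise (fsuc (fsuc (fsuc fzero))) = refl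
  entrywise (fsuc (fsuc (fsuc (fsuc fzero)))) = refl
  entrywise (fsuc (fsuc (fsuc (fsuc (fsuc j)))))
    with (lookup (C₂ n) (fsuc (fsuc (fsuc (fsuc (fsuc j))))) ≡ _) ∋ lookup∘tabulate _ j
  ... | entry with toℕ j <ᵇ n | toℕ j <ᵇ n + suc n
  ... | true  | _     = entry
  ... | false | true  = entry
  ... | false | false = entry

C₃-byKind : ∀ n → C₃ n ≡ byKind n inC₃
C₃-byKind n = byKind-ext n inC₃ entrywise
  where
  entrywise : ∀ x → lookup (C₃ n) x ≡ inC₃ (kind n (toℕ x))
  entrywise fzero = refl
  entrywise (fsuc fzero) = refl
  entrywise (fsuc (fsuc fzero)) = refl
  entrywise (fsuc (fsuc (fsuc fzero))) = refl
  entrywise (fsuc (fsuc (fsuc (fsuc fzero)))) = refl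
  entrywise (fsuc (fsuc (fsuc (fsuc (fsuc j)))))
    with (lookup (C₃ n) (fsuc (fsuc (fsuc (fsuc (fsuc j))))) ≡ _) ∋ lookup∘tabulate _ j
  ... | entry with toℕ j <ᵇ n | toℕ j <ᵇ n + suc n
  ... | true  | _     = entry
  ... | false | true  = entry
  ... | false | false = entry

record KindBasis (n : ℕ) (B : Subset (size n)) : Set where
  field
    size≡n+3 : ∣ B ∣ ≡ n + 3
    avoids-D : ¬ (byKind n inS ⊆ B)
    ⊈C₁      : ¬ (B ⊆ byKind n inC₁)
    ⊈C₂      : ¬ (B ⊆ byKind n inC₂)
    ⊈C₃      : ¬ (B ⊆ byKind n inC₃)
    ⊈H₁      : ¬ (B ⊆ byKind n inH₁)
    ⊈H₂      : ¬ (B ⊆ byKind n inH₂)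
    ⊈H₃      : ¬ (B ⊆ byKind n inH₃)

MIBases≡ : ∀ n B → MIBases n B ≡
  (∣ B ∣ ≡ n + 3 × ¬ (byKind n inS ⊆ B) ×
   ¬ (B ⊆ byKind n inC₁) × ¬ (B ⊆ byKind n inC₂) × ¬ (B ⊆ byKind n inC₃) ×
   ¬ (B ⊆ byKind n inH₁) × ¬ (B ⊆ byKind n inH₂) × ¬ (B ⊆ byKind n inH₃))
MIBases≡ n B
  rewrite S123-byKind n | C₁-byKind n | C₂-byKind n | C₃-byKind n
        | H₁-byKind n | H₂-byKind n | H₃-byKind n = refl

from-MIBases : ∀ {n B} → MIBases n B → KindBasis n B
from-MIBases {n} {B} b with subst (λ A → A) (MIBases≡ n B) b
... | size , d , c₁ , c₂ , c₃ , h₁ , h₂ , h₃ = record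
  { size≡n+3 = size ; avoids-D = d ; ⊈C₁ = c₁ ; ⊈C₂ = c₂ ; ⊈C₃ = c₃ ; ⊈H₁ = h₁ ; ⊈H₂ = h₂ ; ⊈H₃ = h₃ }

to-MIBases : ∀ {n B} → KindBasis n B → MIBases n B
to-MIBases {n} {B} b = subst (λ A → A) (sym (MIBases≡ n B))
  (size≡n+3 , avoids-D , ⊈C₁ , ⊈C₂ , ⊈C₃ , ⊈H₁ , ⊈H₂ , ⊈H₃)
  where open KindBasis b

-- The size of C₁, C₂, C₃ (one block and two of 1,2,3,4) computes to
-- suc (n + 2), which is the rank n + 3.
∣C∣≡n+3 : ∀ n → suc (n + 2) ≡ n + 3
∣C∣≡n+3 n = sym (+-suc n 2)


exchange-basis₁ : ∀ {n e} → e ∈ byKind n inC₁ → MIBases n (exchange (byKind n inC₁) e e₂)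
exchange-basis₁ {n} {e} e∈C₁ = to-MIBases record
  { size≡n+3 = trans (∣exchange∣ e∈C₁ (∉-byKind inC₁ {e₂} refl refl))
                     (trans (∣byKind∣ n inC₁) (∣C∣≡n+3 n))
  ; avoids-D = insert-⊈ᵏ inS k2 k3 refl refl (∉-remove e (∉-byKind inC₁ refl refl))
                                             (∉-remove e (∉-byKind inC₁ refl refl)) (λ ()) e₂
  ; ⊈C₁ = ⊈-witness (exchange-adds (byKind n inC₁) e e₂) (∉-byKind inC₁ {e₂} refl refl)
  ; ⊈C₂ = exchange-⊈ᵏ inC₁ inC₂ k1 kx refl refl (λ ()) e e₂
  ; ⊈C₃ = exchange-⊈ᵏ inC₁ inC₃ k1 kx refl refl (λ ()) e e₂
  ; ⊈H₁ = exchange-⊈ᵏ inC₁ inH₁ k4 kx refl refl (λ ()) e e₂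
  ; ⊈H₂ = exchange-⊈ᵏ inC₁ inH₂ k1 k4 refl refl (λ ()) e e₂
  ; ⊈H₃ = exchange-⊈ᵏ inC₁ inH₃ k1 k4 refl refl (λ ()) e e₂
  }

exchange-basis₂ : ∀ {n e} → e ∈ byKind n inC₂ → MIBases n (exchange (byKind n inC₂) e e₃)
exchange-basis₂ {n} {e} e∈C₂ = to-MIBases record
  { size≡n+3 = trans (∣exchange∣ e∈C₂ (∉-byKind inC₂ {e₃} refl refl))
                     (trans (∣byKind∣ n inC₂) (∣C∣≡n+3 n))
  ; avoids-D = insert-⊈ᵏ inS k1 k3 refl refl (∉-remove e (∉-byKind inC₂ refl refl))
                                             (∉-remove e (∉-byKind inC₂ refl refl)) (λ ()) e₃
  ; ⊈C₁ = exchange-⊈ᵏ inC₂ inC₁ k2 ky refl refl (λ ()) e e₃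
  ; ⊈C₂ = ⊈-witness (exchange-adds (byKind n inC₂) e e₃) (∉-byKind inC₂ {e₃} refl refl)
  ; ⊈C₃ = exchange-⊈ᵏ inC₂ inC₃ k2 ky refl refl (λ ()) e e₃
  ; ⊈H₁ = exchange-⊈ᵏ inC₂ inH₁ k2 k4 refl refl (λ ()) e e₃
  ; ⊈H₂ = exchange-⊈ᵏ inC₂ inH₂ k4 ky refl refl (λ ()) e e₃
  ; ⊈H₃ = exchange-⊈ᵏ inC₂ inH₃ k2 k4 refl refl (λ ()) e e₃
  }

exchange-basis₃ : ∀ {n e} → e ∈ byKind n inC₃ → MIBases n (exchange (byKind n inC₃) e e₁)
exchange-basis₃ {n} {e} e∈C₃ = to-MIBases record
  { size≡n+3 = trans (∣exchange∣ e∈C₃ (∉-byKind inC₃ {e₁} refl refl))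
                     (trans (∣byKind∣ n inC₃) (∣C∣≡n+3 n))
  ; avoids-D = insert-⊈ᵏ inS k1 k2 refl refl (∉-remove e (∉-byKind inC₃ refl refl))
                                             (∉-remove e (∉-byKind inC₃ refl refl)) (λ ()) e₁
  ; ⊈C₁ = exchange-⊈ᵏ inC₃ inC₁ k3 kz refl refl (λ ()) e e₁
  ; ⊈C₂ = exchange-⊈ᵏ inC₃ inC₂ k3 kz refl refl (λ ()) e e₁
  ; ⊈C₃ = ⊈-witness (exchange-adds (byKind n inC₃) e e₁) (∉-byKind inC₃ {e₁} refl refl)
  ; ⊈H₁ = exchange-⊈ᵏ inC₃ inH₁ k3 k4 refl refl (λ ()) e e₁
  ; ⊈H₂ = exchange-⊈ᵏ inC₃ inH₂ k3 k4 refl refl (λ ()) e e₁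
  ; ⊈H₃ = exchange-⊈ᵏ inC₃ inH₃ k4 kz refl refl (λ ()) e e₁
  }

basis-size : ∀ {n B} → MIBases n B → ∣ B ∣ ≡ n + 3
basis-size b = KindBasis.size≡n+3 (from-MIBases b)

circuit-hyperplane : ∀ {n} (P : Kind → Bool) (f : Fin (size n)) →
  ∣ byKind n P ∣ ≡ n + 3 → (∀ {B} → MIBases n B → ¬ (B ⊆ byKind n P)) →
  (∀ {e} → e ∈ byKind n P → MIBases n (exchange (byKind n P) e f)) →
  Circuit (MIBases n) (byKind n P)
circuit-hyperplane P f ∣C∣ no-basis-inside =
  exchange-circuit f (λ b → trans (basis-size b) (sym ∣C∣)) no-basis-inside

circuit-C₁ : ∀ n → Circuit (MIBases n) (byKind n inC₁)
circuit-C₁ n = circuit-hyperplane inC₁ e₂ (trans (∣byKind∣ n inC₁) (∣C∣≡n+3 n))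
  (λ b → KindBasis.⊈C₁ (from-MIBases b)) exchange-basis₁

circuit-C₂ : ∀ n → Circuit (MIBases n) (byKind n inC₂)
circuit-C₂ n = circuit-hyperplane inC₂ e₃ (trans (∣byKind∣ n inC₂) (∣C∣≡n+3 n))
  (λ b → KindBasis.⊈C₂ (from-MIBases b)) exchange-basis₂

circuit-C₃ : ∀ n → Circuit (MIBases n) (byKind n inC₃)
circuit-C₃ n = circuit-hyperplane inC₃ e₁ (trans (∣byKind∣ n inC₃) (∣C∣≡n+3 n))
  (λ b → KindBasis.⊈C₃ (from-MIBases b)) exchange-basis₃

inS-beyond-4 : ∀ n j → inS (kind n (4 + j)) ≡ false
inS-beyond-4 n j with j <ᵇ suc n | j <ᵇ suc n + suc n
... | true  | _     = refl
... | false | true  = refl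
... | false | false = refl

D-elements : ∀ {n} {x : Fin (size n)} → x ∈ byKind n inS → x ≡ e₁ ⊎ x ≡ e₂ ⊎ x ≡ e₃
D-elements {x = fzero}                      _   = inj₁ refl
D-elements {x = fsuc fzero}                 _   = inj₂ (inj₁ refl)
D-elements {x = fsuc (fsuc fzero)}          _   = inj₂ (inj₂ refl)
D-elements {x = fsuc (fsuc (fsuc fzero))}   x∈D with () ← byKind-∈ inS x∈D
D-elements {n} {x = fsuc (fsuc (fsuc (fsuc j)))} x∈D =
  ⊥-elim (not-¬ refl (trans (sym (inS-beyond-4 n (toℕ j))) (byKind-∈ inS x∈D)))

-- {1, 2, 3} is a circuit: no basis contains it, and any two of its elements
-- lie in one of the exchanged circuit-hyperplanes {1,2} ∪ X, {2,3} ∪ Y, {1,3} ∪ Z.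
circuit-D : ∀ n → Circuit (MIBases n) (byKind n inS)
circuit-D n = circuit-intro dependent pair-in-basis
  where
  dependent : ¬ Independent (MIBases n) (byKind n inS)
  dependent (B , b , D⊆B) = KindBasis.avoids-D (from-MIBases b) D⊆B

  B₁₂ B₂₃ B₁₃ : Subset (size n)
  B₁₂ = exchange (byKind n inC₁) e₄ e₂
  B₂₃ = exchange (byKind n inC₂) e₄ e₃
  B₁₃ = exchange (byKind n inC₃) e₄ e₁

  e₁∈B₁₂ : e₁ ∈ B₁₂
  e₁∈B₁₂ = exchange-keeps {C = byKind n inC₁} {e₄} {e₂} (∈-byKind inC₁ {e₁} refl refl) (λ ())
  e₂∈B₂₃ : e₂ ∈ B₂₃
  e₂∈B₂₃ = exchange-keeps {C = byKind n inC₂} {e₄} {e₃} (∈-byKind inC₂ {e₂} refl refl) (λ ())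
  e₃∈B₁₃ : e₃ ∈ B₁₃
  e₃∈B₁₃ = exchange-keeps {C = byKind n inC₃} {e₄} {e₁} (∈-byKind inC₃ {e₃} refl refl) (λ ())
  e₂∈B₁₂ : e₂ ∈ B₁₂
  e₂∈B₁₂ = exchange-adds (byKind n inC₁) e₄ e₂
  e₃∈B₂₃ : e₃ ∈ B₂₃
  e₃∈B₂₃ = exchange-adds (byKind n inC₂) e₄ e₃
  e₁∈B₁₃ : e₁ ∈ B₁₃
  e₁∈B₁₃ = exchange-adds (byKind n inC₃) e₄ e₁

  others-in : ∀ {B e x} → x ∈ byKind n inS → x ≢ e →
    (e ≢ e₁ → e₁ ∈ B) → (e ≢ e₂ → e₂ ∈ B) → (e ≢ e₃ → e₃ ∈ B) → x ∈ B
  others-in x∈D x≢e in₁ in₂ in₃ with D-elements x∈D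
  ... | inj₁ refl        = in₁ (λ e≡x → x≢e (sym e≡x))
  ... | inj₂ (inj₁ refl) = in₂ (λ e≡x → x≢e (sym e≡x))
  ... | inj₂ (inj₂ refl) = in₃ (λ e≡x → x≢e (sym e≡x))

  pair-in-basis : ∀ {e} → e ∈ byKind n inS → Σ (Subset (size n)) λ B →
    MIBases n B × (∀ {x} → x ∈ byKind n inS → x ≢ e → x ∈ B)
  pair-in-basis e∈D with D-elements e∈D
  ... | inj₁ refl = B₂₃ , exchange-basis₂ {n} {e₄} (∈-byKind inC₂ refl refl) , λ x∈D x≢e →
    others-in x∈D x≢e (λ e≢e₁ → ⊥-elim (e≢e₁ refl)) (λ _ → e₂∈B₂₃) (λ _ → e₃∈B₂₃)
  ... | inj₂ (inj₁ refl) = B₁₃ , exchange-basis₃ {n} {e₄} (∈-byKind inC₃ refl refl) , λ x∈D x≢e →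
    others-in x∈D x≢e (λ _ → e₁∈B₁₃) (λ e≢e₂ → ⊥-elim (e≢e₂ refl)) (λ _ → e₃∈B₁₃)
  ... | inj₂ (inj₂ refl) = B₁₂ , exchange-basis₁ {n} {e₄} (∈-byKind inC₁ refl refl) , λ x∈D x≢e →
    others-in x∈D x≢e (λ _ → e₁∈B₁₂) (λ _ → e₂∈B₁₂) (λ e≢e₃ → ⊥-elim (e≢e₃ refl))

-- The sets {1} ∪ Y ⊆ H₁, {2} ∪ Z ⊆ H₂, {3} ∪ X ⊆ H₃, which become bases when
-- any element outside the respective hyperplane is added.
inA₁ inA₂ inA₃ : Kind → Bool
inA₁ = λ { k1 → true ; ky → true ; _ → false }
inA₂ = λ { k2 → true ; kz → true ; _ → false }
inA₃ = λ { k3 → true ; kx → true ; _ → false }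

∣A∪⁅e⁆∣≡n+3 : ∀ {n} (P : Kind → Bool) {e : Fin (size n)} → kindCount n P ≡ suc (n + 1) →
  e ∉ byKind n P → ∣ byKind n P ∪ ⁅ e ⁆ ∣ ≡ n + 3
∣A∪⁅e⁆∣≡n+3 {n} P {e} ∣A∣ e∉A = begin
  ∣ byKind n P ∪ ⁅ e ⁆ ∣  ≡⟨ ∣p∪⁅x⁆∣≡1+∣p∣ e∉A ⟩
  suc ∣ byKind n P ∣     ≡⟨ cong suc (trans (∣byKind∣ n P) ∣A∣) ⟩
  suc (suc (n + 1))      ≡⟨ cong suc (sym (+-suc n 1)) ⟩
  suc (n + 2)            ≡⟨ ∣C∣≡n+3 n ⟩
  n + 3                  ∎
  where open ≡-Reasoning

A₁⊆H₁ : ∀ {n} → byKind n inA₁ ⊆ byKind n inH₁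
A₁⊆H₁ = byKind-⊆ inA₁ inH₁ λ { k1 _ → refl ; ky _ → refl ; k2 () ; k3 () ; k4 () ; kx () ; kz () }

A₂⊆H₂ : ∀ {n} → byKind n inA₂ ⊆ byKind n inH₂
A₂⊆H₂ = byKind-⊆ inA₂ inH₂ λ { k2 _ → refl ; kz _ → refl ; k1 () ; k3 () ; k4 () ; kx () ; ky () }

A₃⊆H₃ : ∀ {n} → byKind n inA₃ ⊆ byKind n inH₃
A₃⊆H₃ = byKind-⊆ inA₃ inH₃ λ { k3 _ → refl ; kx _ → refl ; k1 () ; k2 () ; k4 () ; ky () ; kz () }

extension-basis₁ : ∀ {n e} → e ∉ byKind n inH₁ → MIBases n (byKind n inA₁ ∪ ⁅ e ⁆)
extension-basis₁ {n} {e} e∉H₁ = to-MIBases record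
  { size≡n+3 = ∣A∪⁅e⁆∣≡n+3 inA₁ refl (λ e∈A → e∉H₁ (A₁⊆H₁ e∈A))
  ; avoids-D = insert-⊈ᵏ inS k2 k3 refl refl (∉-byKind inA₁ refl refl) (∉-byKind inA₁ refl refl) (λ ()) e
  ; ⊈C₁ = ⊈-∪ ⁅ e ⁆ (⊈ᵏ inA₁ inC₁ ky refl)
  ; ⊈C₂ = ⊈-∪ ⁅ e ⁆ (⊈ᵏ inA₁ inC₂ k1 refl)
  ; ⊈C₃ = ⊈-∪ ⁅ e ⁆ (⊈ᵏ inA₁ inC₃ k1 refl)
  ; ⊈H₁ = ⊈-witness (x∈p∪q⁺ (inj₂ (x∈⁅x⁆ e))) e∉H₁
  ; ⊈H₂ = ⊈-∪ ⁅ e ⁆ (⊈ᵏ inA₁ inH₂ k1 refl)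
  ; ⊈H₃ = ⊈-∪ ⁅ e ⁆ (⊈ᵏ inA₁ inH₃ k1 refl)
  }

extension-basis₂ : ∀ {n e} → e ∉ byKind n inH₂ → MIBases n (byKind n inA₂ ∪ ⁅ e ⁆)
extension-basis₂ {n} {e} e∉H₂ = to-MIBases record
  { size≡n+3 = ∣A∪⁅e⁆∣≡n+3 inA₂ refl (λ e∈A → e∉H₂ (A₂⊆H₂ e∈A))
  ; avoids-D = insert-⊈ᵏ inS k1 k3 refl refl (∉-byKind inA₂ refl refl) (∉-byKind inA₂ refl refl) (λ ()) e
  ; ⊈C₁ = ⊈-∪ ⁅ e ⁆ (⊈ᵏ inA₂ inC₁ k2 refl)
  ; ⊈C₂ = ⊈-∪ ⁅ e ⁆ (⊈ᵏ inA₂ inC₂ kz refl)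
  ; ⊈C₃ = ⊈-∪ ⁅ e ⁆ (⊈ᵏ inA₂ inC₃ k2 refl)
  ; ⊈H₁ = ⊈-∪ ⁅ e ⁆ (⊈ᵏ inA₂ inH₁ k2 refl)
  ; ⊈H₂ = ⊈-witness (x∈p∪q⁺ (inj₂ (x∈⁅x⁆ e))) e∉H₂
  ; ⊈H₃ = ⊈-∪ ⁅ e ⁆ (⊈ᵏ inA₂ inH₃ k2 refl)
  }

extension-basis₃ : ∀ {n e} → e ∉ byKind n inH₃ → MIBases n (byKind n inA₃ ∪ ⁅ e ⁆)
extension-basis₃ {n} {e} e∉H₃ = to-MIBases record
  { size≡n+3 = ∣A∪⁅e⁆∣≡n+3 inA₃ refl (λ e∈A → e∉H₃ (A₃⊆H₃ e∈A))
  ; avoids-D = insert-⊈ᵏ inS k1 k2 refl refl (∉-byKind inA₃ refl refl) (∉-byKind inA₃ refl refl) (λ ()) e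
  ; ⊈C₁ = ⊈-∪ ⁅ e ⁆ (⊈ᵏ inA₃ inC₁ k3 refl)
  ; ⊈C₂ = ⊈-∪ ⁅ e ⁆ (⊈ᵏ inA₃ inC₂ k3 refl)
  ; ⊈C₃ = ⊈-∪ ⁅ e ⁆ (⊈ᵏ inA₃ inC₃ kx refl)
  ; ⊈H₁ = ⊈-∪ ⁅ e ⁆ (⊈ᵏ inA₃ inH₁ k3 refl)
  ; ⊈H₂ = ⊈-∪ ⁅ e ⁆ (⊈ᵏ inA₃ inH₂ k3 refl)
  ; ⊈H₃ = ⊈-witness (x∈p∪q⁺ (inj₂ (x∈⁅x⁆ e))) e∉H₃
  }

cocircuit-K₁ : ∀ n → Cocircuit (MIBases n) (∁ (byKind n inH₁))
cocircuit-K₁ n = complement-cocircuit (λ b → KindBasis.⊈H₁ (from-MIBases b))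
  A₁⊆H₁
  extension-basis₁

cocircuit-K₂ : ∀ n → Cocircuit (MIBases n) (∁ (byKind n inH₂))
cocircuit-K₂ n = complement-cocircuit (λ b → KindBasis.⊈H₂ (from-MIBases b)) A₂⊆H₂ extension-basis₂

cocircuit-K₃ : ∀ n → Cocircuit (MIBases n) (∁ (byKind n inH₃))
cocircuit-K₃ n = complement-cocircuit (λ b → KindBasis.⊈H₃ (from-MIBases b)) A₃⊆H₃ extension-basis₃

-- The sign configuration forced by orthogonality in M I_n is impossible.
-- δ, γᵢ, κᵢ are the signs on the circuits {1,2,3}, Cᵢ and on the cocircuits
-- E ∖ Hᵢ; the hypotheses say that each circuit/cocircuit pair meeting in
-- {a, b} has opposite parities on {a, b}.  Going around the triangle 1,2,3
-- once through δ and once through κ₁, κ₂, κ₃ (with detours through 4, where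
-- the γᵢ identify the κ-parities) gives parity δ a₁ a₂ equal to both
-- parity κ₃ a₁ a₂ and its negation.
sign-contradiction : {A : Set} (δ γ₁ γ₂ γ₃ κ₁ κ₂ κ₃ : A → Bool) (a₁ a₂ a₃ a₄ : A) →
  parity δ a₂ a₃ ≡ not (parity κ₁ a₂ a₃) →
  parity δ a₁ a₃ ≡ not (parity κ₂ a₁ a₃) →
  parity δ a₁ a₂ ≡ not (parity κ₃ a₁ a₂) →
  parity γ₁ a₁ a₄ ≡ not (parity κ₂ a₁ a₄) → parity γ₁ a₁ a₄ ≡ not (parity κ₃ a₁ a₄) →
  parity γ₂ a₂ a₄ ≡ not (parity κ₁ a₂ a₄) → parity γ₂ a₂ a₄ ≡ not (parity κ₃ a₂ a₄) →
  parity γ₃ a₃ a₄ ≡ not (parity κ₁ a₃ a₄) → parity γ₃ a₃ a₄ ≡ not (parity κ₂ a₃ a₄) →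
  ⊥
sign-contradiction δ γ₁ γ₂ γ₃ κ₁ κ₂ κ₃ a₁ a₂ a₃ a₄
                   δκ₁ δκ₂ δκ₃ γ₁κ₂ γ₁κ₃ γ₂κ₁ γ₂κ₃ γ₃κ₁ γ₃κ₂ =
  not-¬ refl triangle
  where
  open ≡-Reasoning
  κ₂≡κ₃ : parity κ₂ a₁ a₄ ≡ parity κ₃ a₁ a₄
  κ₂≡κ₃ = not-injective (trans (sym γ₁κ₂) γ₁κ₃)
  κ₁≡κ₃ : parity κ₁ a₂ a₄ ≡ parity κ₃ a₂ a₄
  κ₁≡κ₃ = not-injective (trans (sym γ₂κ₁) γ₂κ₃)
  κ₁≡κ₂ : parity κ₁ a₃ a₄ ≡ parity κ₂ a₃ a₄
  κ₁≡κ₂ = not-injective (trans (sym γ₃κ₁) γ₃κ₂)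

  κ₂₁₄ κ₂₃₄ κ₁₂₄ κ₁₃₄ : Bool
  κ₂₁₄ = parity κ₂ a₁ a₄
  κ₂₃₄ = parity κ₂ a₃ a₄
  κ₁₂₄ = parity κ₁ a₂ a₄
  κ₁₃₄ = parity κ₁ a₃ a₄

  triangle : parity κ₃ a₁ a₂ ≡ not (parity κ₃ a₁ a₂)
  triangle = begin
    parity κ₃ a₁ a₂                         ≡⟨ parity-via κ₃ a₁ a₂ a₄ ⟩
    parity κ₃ a₁ a₄ xor parity κ₃ a₂ a₄     ≡⟨ cong₂ _xor_ (sym κ₂≡κ₃) (sym κ₁≡κ₃) ⟩
    κ₂₁₄ xor κ₁₂₄                           ≡⟨ sym (xor-cancel-middle κ₂₁₄ κ₂₃₄ κ₁₂₄) ⟩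
    (κ₂₁₄ xor κ₂₃₄) xor (κ₁₂₄ xor κ₂₃₄)     ≡⟨ cong (λ t → (κ₂₁₄ xor κ₂₃₄) xor (κ₁₂₄ xor t)) (sym κ₁≡κ₂) ⟩
    (κ₂₁₄ xor κ₂₃₄) xor (κ₁₂₄ xor κ₁₃₄)     ≡⟨ sym (cong₂ _xor_ (parity-via κ₂ a₁ a₃ a₄)
                                                                 (parity-via κ₁ a₂ a₃ a₄)) ⟩
    parity κ₂ a₁ a₃ xor parity κ₁ a₂ a₃     ≡⟨ sym (not-xor-not (parity κ₂ a₁ a₃) (parity κ₁ a₂ a₃)) ⟩
    not (parity κ₂ a₁ a₃) xor
      not (parity κ₁ a₂ a₃)                 ≡⟨ sym (cong₂ _xor_ δκ₂ δκ₁) ⟩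
    parity δ a₁ a₃ xor parity δ a₂ a₃       ≡⟨ sym (parity-via δ a₁ a₂ a₃) ⟩
    parity δ a₁ a₂                          ≡⟨ δκ₃ ⟩
    not (parity κ₃ a₁ a₂)                   ∎

Signed : ∀ {n} → Collection (size n) → Subset (size n) → Set
Signed {n} 𝒪 S = Σ (SignedSubset (size n)) λ W → 𝒪 W × supp W ≡ S

σ : ∀ {n} {𝒪 : Collection (size n)} {S} → Signed 𝒪 S → Fin (size n) → Bool
σ W = sign (proj₁ W)

crossing : ∀ {n} {𝒪 𝒪* : Collection (size n)} →
  (∀ U V → 𝒪 U → 𝒪* V → ∣ supp U ∩ supp V ∣ ≡ 2 → Orthogonal U V) →
  ∀ P Q (U : Signed 𝒪 (byKind n P)) (V : Signed 𝒪* (∁ (byKind n Q))) (k l : Kind) →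
  kindCount n (P ∖ᵏ Q) ≡ 2 → (P ∖ᵏ Q) k ≡ true → (P ∖ᵏ Q) l ≡ true → k ≢ l →
  parity (σ U) (rep k) (rep l) ≡ not (parity (σ V) (rep k) (rep l))
crossing {n} orthogonal P Q (U , oU , suppU) (V , oV , suppV) k l two PQk PQl k≢l =
  orthogonal-pair U V ∣U∩V∣≡2 (common k PQk) (common l PQl) (λ eq → k≢l (rep-injective eq))
    (orthogonal U V oU oV ∣U∩V∣≡2)
  where
  U∩V≡P∖Q : supp U ∩ supp V ≡ byKind n (P ∖ᵏ Q)
  U∩V≡P∖Q = trans (cong₂ _∩_ suppU (trans suppV (∁-byKind n Q))) (∩-byKind n P (λ k → not (Q k)))
  ∣U∩V∣≡2 : ∣ supp U ∩ supp V ∣ ≡ 2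
  ∣U∩V∣≡2 = trans (cong ∣_∣ U∩V≡P∖Q) (trans (∣byKind∣ n (P ∖ᵏ Q)) two)
  common : ∀ j → (P ∖ᵏ Q) j ≡ true → rep j ∈ supp U ∩ supp V
  common j PQj = subst (rep j ∈_) (sym U∩V≡P∖Q) (∈-byKind (P ∖ᵏ Q) (kind-rep j) PQj)

lemma5p2 : (n : ℕ) → ¬ WeaklyOrientable (MIBases n)
lemma5p2 n (_ , _ , _ , _ , _ , _ , (_ , signed-circuit) , (_ , signed-cocircuit) , orthogonal)
  with signed-circuit _ (circuit-D n)
     | signed-circuit _ (circuit-C₁ n) | signed-circuit _ (circuit-C₂ n)
     | signed-circuit _ (circuit-C₃ n) | signed-cocircuit _ (cocircuit-K₁ n)
     | signed-cocircuit _ (cocircuit-K₂ n) | signed-cocircuit _ (cocircuit-K₃ n)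
... | δ | γ₁ | γ₂ | γ₃ | κ₁ | κ₂ | κ₃ =
  sign-contradiction (σ δ) (σ γ₁) (σ γ₂) (σ γ₃) (σ κ₁) (σ κ₂) (σ κ₃) e₁ e₂ e₃ e₄
    (crossing orthogonal inS  inH₁ δ  κ₁ k2 k3 refl refl refl (λ ()))
    (crossing orthogonal inS  inH₂ δ  κ₂ k1 k3 refl refl refl (λ ()))
    (crossing orthogonal inS  inH₃ δ  κ₃ k1 k2 refl refl refl (λ ()))
    (crossing orthogonal inC₁ inH₂ γ₁ κ₂ k1 k4 refl refl refl (λ ()))
    (crossing orthogonal inC₁ inH₃ γ₁ κ₃ k1 k4 refl refl refl (λ ()))
    (crossing orthogonal inC₂ inH₁ γ₂ κ₁ k2 k4 refl refl refl (λ ()))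
    (crossing orthogonal inC₂ inH₃ γ₂ κ₃ k2 k4 refl refl refl (λ ()))
    (crossing orthogonal inC₃ inH₁ γ₃ κ₁ k3 k4 refl refl refl (λ ()))
    (crossing orthogonal inC₃ inH₂ γ₃ κ₂ k3 k4 refl refl refl (λ ()))
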